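{- Let $P$ be a finite bounded poset with $|P|>1$ and $\omega$ an admissible map on $P$. Let $r',r''$ be rationals with $0\le r'\le r''<1$, and let $A',A''$ be antichains in $P$ with $A'\le A''$ in $\mathfrak{A}_{\triangledown}(P)$. Then $$\mathfrak{y}_{r''}(A'')\le\mathfrak{y}_{r'}(A'')\le\mathfrak{y}_{r'}(A')$$ in $\mathfrak{A}_{\triangledown}(P)$, where all relative blockers are taken w.r.t. $\omega$. In particular the relative $r$-blocker map is order-reversing on $\mathfrak{A}_{\triangledown}(P)$.
   Context: $P$ is a finite poset with least element $\hat0_P$ and greatest element $\hat1_P$, $|P|>1$. For $A\subseteq P$, $\mathfrak I(A)=\{p: p\le a\text{ for some }a\in A\}$, $\mathfrak F(A)=\{p: p\ge a\text{ for some }a\in A\}$; $\min Q$, $\max Q$ denote minimal/maximal elements of $Q\subseteq P$. $\mathfrak{A}_{\vartriangle}(P)$: all antichains (including empty) ordered by $A'\le A''$ iff $\mathfrak I(A')\subseteq\mathfrak I(A'')$, with meet $A'\wedge_{\vartriangle}A''=\max(\mathfrak I(A')\cap\mathfrak I(A''))$. $\mathfrak{A}_{\triangledown}(P)$: all antichains ordered by $A'\le A''$ iff $\mathfrak F(A')\subseteq\mathfrak F(A'')$; least element $\emptyset$, greatest element $\{\hat0_P\}$; these two are the trivial antichains. Admissible map: $\omega:\mathfrak{A}_{\vartriangle}(P)\to\{ -1\}\cup\mathbb N$ with $\omega(\emptyset)=-1$, $\omega(\{\hat0_P\})=0$, $0<\omega(A')\le\omega(A'')$ whenever $\{\hat0_P\}<A'\le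 A''$ in $\mathfrak{A}_{\vartriangle}(P)$; $\omega(b):=\omega(\{b\})$. For rational $0\le r<1$ and nontrivial antichain $A$, the relative $r$-blocker is $\mathfrak{y}_r(A)=\min\{b\in P\setminus\{\hat0_P\}: \omega(\{b\}\wedge_{\vartriangle}\{a\})/\omega(b)>r\ \forall a\in A\}$; for trivial antichains, $\mathfrak{y}_r(\emptyset)=\{\hat0_P\}$ and $\mathfrak{y}_r(\{\hat0_P\})=\emptyset$. -}

module Defs where

open import Data.Nat using (ℕ; _<_)
open import Data.Integer as ℤ using (ℤ; +_; -[1+_])
open import Data.Rational as ℚ using (ℚ)
open import Data.Rational.Properties as ℚP using ()
open import Data.Fin using (Fin)
open import Data.Fin.Properties using () renaming (_≟_ to _≟ᶠ_)
open import Data.Fin.Subset using (Subset; _∈_; _⊆_; _∩_; ⁅_⁆; ⊥)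
open import Data.Vec using (tabulate; lookup)
open import Data.Vec.Properties using (≡-dec)
open import Data.List using (allFin)
open import Data.Bool.ListAction using (all; any)
open import Data.Bool using (Bool; true; false; _∧_; _∨_; not; if_then_else_)
open import Data.Bool.Properties using () renaming (_≟_ to _≟ᵇ_)
open import Data.Product using (_×_)
open import Relation.Nullary using (¬_)
open import Relation.Nullary.Decidable using (⌊_⌋)
open import Relation.Binary using (Decidable; IsPartialOrder)
open import Relation.Binary.PropositionalEquality using (_≡_)

record BoundedPoset : Set₁ where
  field
    n          : ℕ
    _≤_        : Fin n → Fin n → Set
    isPO       : IsPartialOrder _≡_ _≤_
    _≤?_       : Decidable _≤_
    bot        : Fin n
    top        : Fin n
    bot-least  : ∀ x → bot ≤ x
    top-great  : ∀ x → x ≤ top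
    size>1     : 1 < n

module _ (P : BoundedPoset) where
  open BoundedPoset P

  leᵇ : Fin n → Fin n → Bool
  leᵇ x y = ⌊ x ≤? y ⌋

  eqᵇ : Fin n → Fin n → Bool
  eqᵇ x y = ⌊ x ≟ᶠ y ⌋

  ltᵇ : Fin n → Fin n → Bool
  ltᵇ x y = leᵇ x y ∧ not (eqᵇ x y)

  ∀ᵇ : (Fin n → Bool) → Bool
  ∀ᵇ f = all f (allFin n)

  ∃ᵇ : (Fin n → Bool) → Bool
  ∃ᵇ f = any f (allFin n)

  IsAntichain : Subset n → Set
  IsAntichain A = ∀ x y → x ∈ A → y ∈ A → x ≤ y → x ≡ y

  𝔍 : Subset n → Subset n
  𝔍 A = tabulate (λ p → ∃ᵇ (λ a → lookup A a ∧ leᵇ p a))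

  𝔉 : Subset n → Subset n
  𝔉 A = tabulate (λ p → ∃ᵇ (λ a → lookup A a ∧ leᵇ a p))

  maxS : Subset n → Subset n
  maxS Q = tabulate (λ p → lookup Q p ∧ not (∃ᵇ (λ q → lookup Q q ∧ ltᵇ p q)))

  minS : Subset n → Subset n
  minS Q = tabulate (λ p → lookup Q p ∧ not (∃ᵇ (λ q → lookup Q q ∧ ltᵇ q p)))

  _≤△_ : Subset n → Subset n → Set
  A ≤△ B = 𝔍 A ⊆ 𝔍 B

  _∧△_ : Subset n → Subset n → Subset n
  A ∧△ B = maxS (𝔍 A ∩ 𝔍 B)

  _≤▽_ : Subset n → Subset n → Set
  A ≤▽ B = 𝔉 A ⊆ 𝔉 B

  -- admissible map ω : 𝔄_△(P) → {-1} ∪ ℕ (given on all subsets; only its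
  -- values on antichains are constrained / used)
  record Admissible (ω : Subset n → ℤ) : Set where
    field
      ω-empty : ω ⊥ ≡ -[1+ 0 ]
      ω-bot   : ω ⁅ bot ⁆ ≡ + 0
      ω-mono  : ∀ A' A'' → IsAntichain A' → IsAntichain A'' →
                ⁅ bot ⁆ ≤△ A' → ¬ (A' ≡ ⁅ bot ⁆) → A' ≤△ A'' →
                (+ 0 ℤ.< ω A') × (ω A' ℤ.≤ ω A'')

  toℚ : ℤ → ℚ
  toℚ z = z ℚ./ 1

  -- ω({b} ∧ {a}) / ω(b) > r, written as r · ω(b) < ω({b} ∧ {a})
  -- (equivalent since ω(b) > 0 for b ≠ 0̂ when ω is admissible)
  condᵇ : (Subset n → ℤ) → ℚ → Fin n → Fin n → Bool
  condᵇ ω r b a = ⌊ (r ℚ.* toℚ (ω ⁅ b ⁆)) ℚP.<? toℚ (ω (⁅ b ⁆ ∧△ ⁅ a ⁆)) ⌋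

  isTrivialᵇ : Subset n → Bool
  isTrivialᵇ A = ⌊ ≡-dec _≟ᵇ_ A ⊥ ⌋ ∨ ⌊ ≡-dec _≟ᵇ_ A ⁅ bot ⁆ ⌋

  blocker : (Subset n → ℤ) → ℚ → Subset n → Subset n
  blocker ω r A =
    if ⌊ ≡-dec _≟ᵇ_ A ⊥ ⌋ then ⁅ bot ⁆
    else if ⌊ ≡-dec _≟ᵇ_ A ⁅ bot ⁆ ⌋ then ⊥
    else minS (tabulate (λ b → not (eqᵇ b bot) ∧
                 ∀ᵇ (λ a → not (lookup A a) ∨ condᵇ ω r b a)))

{-# OPTIONS --safe #-}
-- For a nontrivial antichain A, 𝔶_r(A) is the set of minimal elements of
-- B_r(A) = {b ≠ 0̂ : r·ω(b) < ω({b} ∧ {a}) for all a ∈ A}, and taking minimal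
-- elements turns inclusion into the order of 𝔄_▽(P).  Raising r shrinks B_r(A).
-- If A' ≤ A'' in 𝔄_▽(P), each a' ∈ A' lies above some a'' ∈ A'', so
-- {b} ∧ {a''} ≤ {b} ∧ {a'}; since r ≥ 0, r·ω(b) < ω({b} ∧ {a''}) rules out
-- {b} ∧ {a''} = {0̂}, and admissibility gives ω({b} ∧ {a''}) ≤ ω({b} ∧ {a'}),
-- hence B_r(A'') ⊆ B_r(A').  The trivial antichains are the extremes of
-- 𝔄_▽(P); the only delicate mixed case, A' = {0̂} with A'' nontrivial, is
-- impossible because A'' is an antichain.
module Submission where

open import Defs
open import Data.Integer using (ℤ)
open import Data.Rational using (ℚ; 0ℚ; 1ℚ; _≤_; _<_)
open import Data.Fin.Subset using (Subset)
open import Data.Product using (_×_)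

open import Data.Bool using (Bool; true; false; T; not; _∧_; _∨_)
open import Data.Bool.ListAction using (all; any)
open import Data.Bool.Properties using (T-≡; T-∧; T-∨) renaming (_≟_ to _≟ᵇ_)
open import Data.Empty using (⊥-elim)
open import Data.Fin using (Fin)
open import Data.Fin.Properties using () renaming (_≟_ to _≟ᶠ_)
open import Data.Fin.Induction using (po-wellFounded; po-noetherian)
open import Data.Fin.Subset using (_∈_; _∉_; _⊆_; _∩_; ⁅_⁆; ⊥)
open import Data.Fin.Subset.Properties
  using (⊆-refl; ⊆-antisym; x∈⁅x⁆; x∈⁅y⁆⇒x≡y; x∈p∩q⁺; x∈p∩q⁻; ∉⊥; Empty-unique)
import Data.Integer as ℤ
import Data.Integer.Properties as ℤP
open import Data.List using (allFin)
open import Data.List.Membership.Propositional using (lose)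
open import Data.List.Membership.Propositional.Properties using (∈-allFin)
open import Data.List.Relation.Unary.All as All using ()
open import Data.List.Relation.Unary.All.Properties using (all⁺; all⁻)
open import Data.List.Relation.Unary.Any using (satisfied)
open import Data.List.Relation.Unary.Any.Properties using (any⁺; any⁻)
open import Data.Nat using (ℕ)
open import Data.Product using (∃; _,_; proj₁; proj₂)
open import Data.Sum using (inj₁; inj₂; [_,_])
import Data.Rational as ℚ
import Data.Rational.Properties as ℚP
open import Data.Rational.Unnormalised using (mkℚᵘ; *≤*)
import Data.Rational.Unnormalised.Properties as ℚᵘP
open import Data.Unit using (tt)
open import Data.Vec using (tabulate; lookup)
open import Data.Vec.Properties using (≡-dec; lookup∘tabulate; []=⇒lookup; lookup⇒[]=)
open import Function using (_∘_; flip; Equivalence)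
open import Induction.WellFounded using (WellFounded; Acc; acc; module Subrelation)
open import Relation.Binary using (Rel; Reflexive; Transitive; IsPartialOrder)
open import Relation.Binary.PropositionalEquality using (_≡_; _≢_; refl; sym; trans; cong; subst)
open import Relation.Nullary using (¬_; yes; no)
open import Relation.Nullary.Decidable using (T?; toWitness; fromWitness)

open Equivalence using (to; from)

T-not⁺ : ∀ {b} → ¬ T b → T (not b)
T-not⁺ {false} _  = tt
T-not⁺ {true}  ¬b = ¬b tt

T-not⁻ : ∀ {b} → T (not b) → ¬ T b
T-not⁻ {false} _ ()

-- toℚ z = z / 1 is fromℚᵘ of the unnormalised fraction z/1.
toℚ-mono : ∀ (P : BoundedPoset) {u v} → u ℤ.≤ v → toℚ P u ≤ toℚ P v
toℚ-mono P {u} {v} u≤v = ℚP.toℚᵘ-cancel-≤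
  (ℚᵘP.≤-respˡ-≃ (ℚᵘP.≃-sym (ℚP.toℚᵘ-fromℚᵘ (mkℚᵘ u 0)))
  (ℚᵘP.≤-respʳ-≃ (ℚᵘP.≃-sym (ℚP.toℚᵘ-fromℚᵘ (mkℚᵘ v 0)))
  (*≤* (ℤP.*-monoʳ-≤-nonNeg (ℤ.+ 1) u≤v))))

module _ {n : ℕ} where

  ∈⇒T-lookup : ∀ {A : Subset n} {x} → x ∈ A → T (lookup A x)
  ∈⇒T-lookup x∈A = from T-≡ ([]=⇒lookup x∈A)

  T-lookup⇒∈ : ∀ {A : Subset n} {x} → T (lookup A x) → x ∈ A
  T-lookup⇒∈ {A} {x} t = lookup⇒[]= x A (to T-≡ t)

  ∈-tabulate⁺ : ∀ {f : Fin n → Bool} {x} → T (f x) → x ∈ tabulate f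
  ∈-tabulate⁺ {f} {x} t = T-lookup⇒∈ (subst T (sym (lookup∘tabulate f x)) t)

  ∈-tabulate⁻ : ∀ {f : Fin n → Bool} {x} → x ∈ tabulate f → T (f x)
  ∈-tabulate⁻ {f} {x} x∈ = subst T (lookup∘tabulate f x) (∈⇒T-lookup x∈)

  T-any-allFin⁺ : ∀ (f : Fin n → Bool) {x} → T (f x) → T (any f (allFin n))
  T-any-allFin⁺ f {x} = any⁺ f ∘ lose (∈-allFin x)

  T-any-allFin⁻ : ∀ (f : Fin n → Bool) → T (any f (allFin n)) → ∃ (T ∘ f)
  T-any-allFin⁻ f = satisfied ∘ any⁻ f (allFin n)

  T-all-allFin⁺ : ∀ (f : Fin n → Bool) → (∀ x → T (f x)) → T (all f (allFin n))
  T-all-allFin⁺ f h = all⁻ f {xs = allFin n} (All.tabulate λ {x} _ → h x)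

  T-all-allFin⁻ : ∀ (f : Fin n → Bool) → T (all f (allFin n)) → ∀ x → T (f x)
  T-all-allFin⁻ f t x = All.lookup (all⁺ f (allFin n) t) (∈-allFin x)

module _ {n : ℕ} (lt : Fin n → Fin n → Bool) where

  belowIn : Subset n → Fin n → Fin n → Bool
  belowIn Q p q = lookup Q q ∧ lt q p

  -- minS P = extremals (ltᵇ P) and maxS P = extremals (flip (ltᵇ P)) definitionally.
  extremals : Subset n → Subset n
  extremals Q = tabulate λ p → lookup Q p ∧ not (any (belowIn Q p) (allFin n))

  ∈-extremals⁻ : ∀ {Q p} → p ∈ extremals Q → p ∈ Q × (∀ {q} → q ∈ Q → ¬ T (lt q p))
  ∈-extremals⁻ {Q} {p} p∈ =
    let p∈Q , nothing-below = to (T-∧ {lookup Q p}) (∈-tabulate⁻ p∈)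
    in T-lookup⇒∈ p∈Q , λ q∈Q q<p →
         T-not⁻ nothing-below (T-any-allFin⁺ (belowIn Q p) (from T-∧ (∈⇒T-lookup q∈Q , q<p)))

  extremal-below : ∀ {ℓ} {_≼_ : Rel (Fin n) ℓ} → Reflexive _≼_ → Transitive _≼_ →
                   (∀ {x y} → T (lt x y) → x ≼ y) → WellFounded (λ x y → T (lt x y)) →
                   ∀ {Q p} → p ∈ Q → ∃ λ m → m ∈ extremals Q × m ≼ p
  extremal-below {_≼_ = _≼_} ≼-refl ≼-trans lt⇒≼ wf {Q} {p} p∈Q = go (wf p) p∈Q
    where
    go : ∀ {p} → Acc (λ x y → T (lt x y)) p → p ∈ Q → ∃ λ m → m ∈ extremals Q × m ≼ p
    go {p} (acc below) p∈Q with T? (any (belowIn Q p) (allFin n))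
    ... | no nothing-below =
      p , ∈-tabulate⁺ (from (T-∧ {lookup Q p}) (∈⇒T-lookup p∈Q , T-not⁺ nothing-below)) , ≼-refl
    ... | yes something-below =
      let q , q∈Q∧q<p = T-any-allFin⁻ (belowIn Q p) something-below
          q∈Q , q<p = to (T-∧ {lookup Q q}) q∈Q∧q<p
          m , m∈ , m≼q = go (below q<p) (T-lookup⇒∈ q∈Q)
      in m , m∈ , ≼-trans m≼q (lt⇒≼ q<p)

module _ (P : BoundedPoset) where
  open BoundedPoset P renaming (_≤_ to _⊑_; _≤?_ to _⊑?_)
  open IsPartialOrder isPO using () renaming (refl to ⊑-refl; trans to ⊑-trans; antisym to ⊑-antisym)

  T-ltᵇ⁻ : ∀ {x y} → T (ltᵇ P x y) → x ⊑ y × x ≢ y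
  T-ltᵇ⁻ {x} {y} t =
    let x⊑y , x≢y = to (T-∧ {leᵇ P x y}) t
    in toWitness x⊑y , T-not⁻ x≢y ∘ fromWitness

  T-ltᵇ⁺ : ∀ {x y} → x ⊑ y → x ≢ y → T (ltᵇ P x y)
  T-ltᵇ⁺ {x} {y} x⊑y x≢y =
    from (T-∧ {leᵇ P x y}) (fromWitness {a? = x ⊑? y} x⊑y , T-not⁺ (x≢y ∘ toWitness))

  ∈-𝔉⁺ : ∀ {A a p} → a ∈ A → a ⊑ p → p ∈ 𝔉 P A
  ∈-𝔉⁺ {A} {a} {p} a∈A a⊑p =
    ∈-tabulate⁺ (T-any-allFin⁺ (λ a → lookup A a ∧ leᵇ P a p)
      (from (T-∧ {lookup A a}) (∈⇒T-lookup a∈A , fromWitness a⊑p)))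

  ∈-𝔉⁻ : ∀ {A p} → p ∈ 𝔉 P A → ∃ λ a → a ∈ A × a ⊑ p
  ∈-𝔉⁻ {A} {p} p∈ =
    let a , t = T-any-allFin⁻ (λ a → lookup A a ∧ leᵇ P a p) (∈-tabulate⁻ p∈)
        a∈A , a⊑p = to (T-∧ {lookup A a}) t
    in a , T-lookup⇒∈ a∈A , toWitness a⊑p

  ∈-𝔍⁺ : ∀ {A a p} → a ∈ A → p ⊑ a → p ∈ 𝔍 P A
  ∈-𝔍⁺ {A} {a} {p} a∈A p⊑a =
    ∈-tabulate⁺ (T-any-allFin⁺ (λ a → lookup A a ∧ leᵇ P p a)
      (from (T-∧ {lookup A a}) (∈⇒T-lookup a∈A , fromWitness p⊑a)))

  ∈-𝔍⁻ : ∀ {A p} → p ∈ 𝔍 P A → ∃ λ a → a ∈ A × p ⊑ a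
  ∈-𝔍⁻ {A} {p} p∈ =
    let a , t = T-any-allFin⁻ (λ a → lookup A a ∧ leᵇ P p a) (∈-tabulate⁻ p∈)
        a∈A , p⊑a = to (T-∧ {lookup A a}) t
    in a , T-lookup⇒∈ a∈A , toWitness p⊑a

  minS⊆ : ∀ {Q} → minS P Q ⊆ Q
  minS⊆ = proj₁ ∘ ∈-extremals⁻ (ltᵇ P)

  maxS⊆ : ∀ {Q} → maxS P Q ⊆ Q
  maxS⊆ = proj₁ ∘ ∈-extremals⁻ (flip (ltᵇ P))

  minimal-below : ∀ {Q p} → p ∈ Q → ∃ λ m → m ∈ minS P Q × m ⊑ p
  minimal-below = extremal-below (ltᵇ P) ⊑-refl ⊑-trans (proj₁ ∘ T-ltᵇ⁻)
    (Subrelation.wellFounded T-ltᵇ⁻ (po-wellFounded isPO))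

  maximal-above : ∀ {Q p} → p ∈ Q → ∃ λ m → m ∈ maxS P Q × p ⊑ m
  maximal-above = extremal-below (flip (ltᵇ P)) ⊑-refl (flip ⊑-trans) (proj₁ ∘ T-ltᵇ⁻)
    (Subrelation.wellFounded T-ltᵇ⁻ (po-noetherian isPO))

  maxS-antichain : ∀ Q → IsAntichain P (maxS P Q)
  maxS-antichain Q x y x∈ y∈ x⊑y with x ≟ᶠ y
  ... | yes x≡y = x≡y
  ... | no x≢y = ⊥-elim (proj₂ (∈-extremals⁻ (flip (ltᵇ P)) {Q} x∈) (maxS⊆ y∈) (T-ltᵇ⁺ x⊑y x≢y))

  ≤▽-below : ∀ {A B a} → _≤▽_ P A B → a ∈ A → ∃ λ b → b ∈ B × b ⊑ a
  ≤▽-below A≤B a∈A = ∈-𝔉⁻ (A≤B (∈-𝔉⁺ a∈A ⊑-refl))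

  minS-monotone : ∀ {Q R} → Q ⊆ R → _≤▽_ P (minS P Q) (minS P R)
  minS-monotone Q⊆R p∈ =
    let a , a∈ , a⊑p = ∈-𝔉⁻ p∈
        m , m∈ , m⊑a = minimal-below (Q⊆R (minS⊆ a∈))
    in ∈-𝔉⁺ m∈ (⊑-trans m⊑a a⊑p)

  maxS-monotone : ∀ {Q R} → Q ⊆ R → _≤△_ P (maxS P Q) (maxS P R)
  maxS-monotone Q⊆R p∈ =
    let a , a∈ , p⊑a = ∈-𝔍⁻ p∈
        m , m∈ , a⊑m = maximal-above (Q⊆R (maxS⊆ a∈))
    in ∈-𝔍⁺ m∈ (⊑-trans p⊑a a⊑m)

  ∉𝔉⊥ : ∀ {p} → p ∉ 𝔉 P ⊥
  ∉𝔉⊥ p∈ = let _ , a∈⊥ , _ = ∈-𝔉⁻ p∈ in ∉⊥ a∈⊥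

  ∈𝔉⁅bot⁆ : ∀ p → p ∈ 𝔉 P ⁅ bot ⁆
  ∈𝔉⁅bot⁆ p = ∈-𝔉⁺ (x∈⁅x⁆ bot) (bot-least p)

  ≤▽⊥⇒≡⊥ : ∀ {A} → _≤▽_ P A ⊥ → A ≡ ⊥
  ≤▽⊥⇒≡⊥ A≤⊥ = Empty-unique λ (a , a∈A) → let _ , b∈⊥ , _ = ≤▽-below A≤⊥ a∈A in ∉⊥ b∈⊥

  ⁅bot⁆≤▽⇒≡⁅bot⁆ : ∀ {A} → IsAntichain P A → _≤▽_ P ⁅ bot ⁆ A → A ≡ ⁅ bot ⁆
  ⁅bot⁆≤▽⇒≡⁅bot⁆ {A} antichain ⁅bot⁆≤A = ⊆-antisym A⊆⁅bot⁆ ⁅bot⁆⊆A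
    where
    bot∈A : bot ∈ A
    bot∈A =
      let a , a∈A , a⊑bot = ≤▽-below ⁅bot⁆≤A (x∈⁅x⁆ bot)
      in subst (_∈ A) (⊑-antisym a⊑bot (bot-least a)) a∈A

    A⊆⁅bot⁆ : A ⊆ ⁅ bot ⁆
    A⊆⁅bot⁆ {x} x∈A = subst (_∈ ⁅ bot ⁆) (antichain bot x bot∈A x∈A (bot-least x)) (x∈⁅x⁆ bot)

    ⁅bot⁆⊆A : ⁅ bot ⁆ ⊆ A
    ⁅bot⁆⊆A x∈⁅bot⁆ = subst (_∈ A) (sym (x∈⁅y⁆⇒x≡y bot x∈⁅bot⁆)) bot∈A

  ⁅⁆-antichain : ∀ x → IsAntichain P ⁅ x ⁆
  ⁅⁆-antichain x y z y∈ z∈ _ = trans (x∈⁅y⁆⇒x≡y x y∈) (sym (x∈⁅y⁆⇒x≡y x z∈))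

  ⁅⁆-monotone△ : ∀ {x y} → x ⊑ y → _≤△_ P ⁅ x ⁆ ⁅ y ⁆
  ⁅⁆-monotone△ {x} x⊑y p∈ =
    let _ , x'∈ , p⊑x' = ∈-𝔍⁻ p∈
    in ∈-𝔍⁺ (x∈⁅x⁆ _) (⊑-trans (subst (_ ⊑_) (x∈⁅y⁆⇒x≡y x x'∈) p⊑x') x⊑y)

  ⁅bot⁆≤△ : ∀ {A x} → x ∈ A → _≤△_ P ⁅ bot ⁆ A
  ⁅bot⁆≤△ {x = x} x∈A p∈ =
    let _ , b∈ , p⊑b = ∈-𝔍⁻ p∈
    in ∈-𝔍⁺ x∈A (⊑-trans (subst (_ ⊑_) (x∈⁅y⁆⇒x≡y bot b∈) p⊑b) (bot-least x))

  ∧△-monotoneʳ : ∀ {C A B} → _≤△_ P A B → _≤△_ P (_∧△_ P C A) (_∧△_ P C B)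
  ∧△-monotoneʳ {C} {A} A≤B =
    maxS-monotone λ x∈ → let x∈𝔍C , x∈𝔍A = x∈p∩q⁻ (𝔍 P C) (𝔍 P A) x∈ in x∈p∩q⁺ (x∈𝔍C , A≤B x∈𝔍A)

  ⁅bot⁆≤△∧△ : ∀ {A B x y} → x ∈ A → y ∈ B → _≤△_ P ⁅ bot ⁆ (_∧△_ P A B)
  ⁅bot⁆≤△∧△ {x = x} {y} x∈A y∈B =
    let _ , m∈ , _ = maximal-above (x∈p∩q⁺ (∈-𝔍⁺ x∈A (bot-least x) , ∈-𝔍⁺ y∈B (bot-least y)))
    in ⁅bot⁆≤△ m∈

module _ (P : BoundedPoset) (ω : Subset (BoundedPoset.n P) → ℤ) where
  open BoundedPoset P renaming (_≤_ to _⊑_)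

  Blocks : ℚ → Fin n → Fin n → Set
  Blocks r b a = r ℚ.* toℚ P (ω ⁅ b ⁆) < toℚ P (ω (_∧△_ P ⁅ b ⁆ ⁅ a ⁆))

  -- Literally the set inside Defs.blocker, so that blocker reduces to
  -- minS P (blocking r A) once A is known to be nontrivial.
  blocking : ℚ → Subset n → Subset n
  blocking r A = tabulate λ b → not (eqᵇ P b bot) ∧ ∀ᵇ P (λ a → not (lookup A a) ∨ condᵇ P ω r b a)

  ∈-blocking⁺ : ∀ {r A b} → b ≢ bot → (∀ {a} → a ∈ A → Blocks r b a) → b ∈ blocking r A
  ∈-blocking⁺ {r} {A} {b} b≢bot blocks =
    ∈-tabulate⁺ (from (T-∧ {not (eqᵇ P b bot)}) (T-not⁺ (b≢bot ∘ toWitness) , T-all-allFin⁺ _ blocks-a))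
    where
    blocks-a : ∀ a → T (not (lookup A a) ∨ condᵇ P ω r b a)
    blocks-a a with T? (lookup A a)
    ... | yes a∈A = from (T-∨ {not (lookup A a)}) (inj₂ (fromWitness (blocks (T-lookup⇒∈ a∈A))))
    ... | no  a∉A = from (T-∨ {not (lookup A a)}) (inj₁ (T-not⁺ a∉A))

  ∈-blocking⁻ : ∀ {r A b} → b ∈ blocking r A → b ≢ bot × (∀ {a} → a ∈ A → Blocks r b a)
  ∈-blocking⁻ {r} {A} {b} b∈ =
    let b≢bot , blocks-all = to (T-∧ {not (eqᵇ P b bot)}) (∈-tabulate⁻ b∈)
    in T-not⁻ b≢bot ∘ fromWitness {a? = b ≟ᶠ bot} , λ {a} a∈A →
         [ (λ a∉A → ⊥-elim (T-not⁻ a∉A (∈⇒T-lookup a∈A))) , toWitness ]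
           (to (T-∨ {not (lookup A a)}) (T-all-allFin⁻ _ blocks-all a))

  module _ (admissible : Admissible P ω) where
    open Admissible admissible

    ω-nonneg : ∀ {b} → b ≢ bot → 0ℚ ≤ toℚ P (ω ⁅ b ⁆)
    ω-nonneg {b} b≢bot = toℚ-mono P (ℤP.<⇒≤ (proj₁
      (ω-mono ⁅ b ⁆ ⁅ b ⁆ (⁅⁆-antichain P b) (⁅⁆-antichain P b)
              (⁅bot⁆≤△ P (x∈⁅x⁆ b)) ⁅b⁆≢⁅bot⁆ ⊆-refl)))
      where
      ⁅b⁆≢⁅bot⁆ : ⁅ b ⁆ ≢ ⁅ bot ⁆
      ⁅b⁆≢⁅bot⁆ eq = b≢bot (x∈⁅y⁆⇒x≡y bot (subst (b ∈_) eq (x∈⁅x⁆ b)))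

    Blocks-antitoneˡ : ∀ {r' r'' b a} → r' ≤ r'' → b ≢ bot → Blocks r'' b a → Blocks r' b a
    Blocks-antitoneˡ {b = b} r'≤r'' b≢bot = ℚP.≤-<-trans
      (ℚP.*-monoʳ-≤-nonNeg (toℚ P (ω ⁅ b ⁆)) {{ℚ.nonNegative (ω-nonneg b≢bot)}} r'≤r'')

    Blocks-monotoneʳ : ∀ {r b a'' a'} → 0ℚ ≤ r → b ≢ bot → a'' ⊑ a' → Blocks r b a'' → Blocks r b a'
    Blocks-monotoneʳ {r} {b} {a''} {a'} 0≤r b≢bot a''⊑a' blocks =
      ℚP.<-≤-trans blocks (toℚ-mono P ω-meet-mono)
      where
      0≤rω : 0ℚ ≤ r ℚ.* toℚ P (ω ⁅ b ⁆)
      0≤rω = ℚP.nonNegative⁻¹ _ {{ℚP.nonNeg*nonNeg⇒nonNeg r {{ℚ.nonNegative 0≤r}}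
                                                        _ {{ℚ.nonNegative (ω-nonneg b≢bot)}}}}

      -- ω vanishes on {0̂}, which cannot exceed r·ω(b) ≥ 0.
      meet≢⁅bot⁆ : _∧△_ P ⁅ b ⁆ ⁅ a'' ⁆ ≢ ⁅ bot ⁆
      meet≢⁅bot⁆ eq = ℚP.<-irrefl refl (ℚP.≤-<-trans 0≤rω
        (subst (λ z → r ℚ.* toℚ P (ω ⁅ b ⁆) < toℚ P z) (trans (cong ω eq) ω-bot) blocks))

      ω-meet-mono : ω (_∧△_ P ⁅ b ⁆ ⁅ a'' ⁆) ℤ.≤ ω (_∧△_ P ⁅ b ⁆ ⁅ a' ⁆)
      ω-meet-mono = proj₂ (ω-mono _ _
        (maxS-antichain P (𝔍 P ⁅ b ⁆ ∩ 𝔍 P ⁅ a'' ⁆)) (maxS-antichain P (𝔍 P ⁅ b ⁆ ∩ 𝔍 P ⁅ a' ⁆))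
        (⁅bot⁆≤△∧△ P (x∈⁅x⁆ b) (x∈⁅x⁆ a'')) meet≢⁅bot⁆
        (∧△-monotoneʳ P {⁅ b ⁆} {⁅ a'' ⁆} {⁅ a' ⁆} (⁅⁆-monotone△ P a''⊑a')))

    blocking-antitoneˡ : ∀ {r' r'' A} → r' ≤ r'' → blocking r'' A ⊆ blocking r' A
    blocking-antitoneˡ {r'} {r''} {A} r'≤r'' b∈ =
      let b≢bot , blocks = ∈-blocking⁻ {r''} {A} b∈
      in ∈-blocking⁺ {r'} {A} b≢bot λ {a} a∈A → Blocks-antitoneˡ {a = a} r'≤r'' b≢bot (blocks a∈A)

    blocking-antitoneʳ : ∀ {r A' A''} → 0ℚ ≤ r → _≤▽_ P A' A'' → blocking r A'' ⊆ blocking r A'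
    blocking-antitoneʳ {r} {A'} {A''} 0≤r A'≤A'' b∈ =
      let b≢bot , blocks = ∈-blocking⁻ {r} {A''} b∈
      in ∈-blocking⁺ {r} {A'} b≢bot λ a'∈A' →
           let a'' , a''∈A'' , a''⊑a' = ≤▽-below P A'≤A'' a'∈A'
           in Blocks-monotoneʳ 0≤r b≢bot a''⊑a' (blocks a''∈A'')

    blocker-antitoneˡ : ∀ {r' r''} → r' ≤ r'' → ∀ A → _≤▽_ P (blocker P ω r'' A) (blocker P ω r' A)
    blocker-antitoneˡ {r'} {r''} r'≤r'' A with ≡-dec _≟ᵇ_ A ⊥
    ... | yes _ = ⊆-refl
    ... | no _ with ≡-dec _≟ᵇ_ A ⁅ bot ⁆
    ...   | yes _ = ⊆-refl
    ...   | no _  = minS-monotone P {blocking r'' A} {blocking r' A} (blocking-antitoneˡ {A = A} r'≤r'')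

    blocker-antitoneʳ : ∀ {r A' A''} → 0ℚ ≤ r → IsAntichain P A'' → _≤▽_ P A' A'' →
                        _≤▽_ P (blocker P ω r A'') (blocker P ω r A')
    blocker-antitoneʳ {r} {A'} {A''} 0≤r A''-antichain A'≤A''
      with ≡-dec _≟ᵇ_ A'' ⊥ | ≡-dec _≟ᵇ_ A'' ⁅ bot ⁆ | ≡-dec _≟ᵇ_ A' ⊥ | ≡-dec _≟ᵇ_ A' ⁅ bot ⁆
    ... | yes _     | _     | yes _     | _     = ⊆-refl
    ... | yes A''≡⊥ | _     | no A'≢⊥   | _     =
      ⊥-elim (A'≢⊥ (≤▽⊥⇒≡⊥ P (subst (_≤▽_ P A') A''≡⊥ A'≤A'')))
    ... | no _      | yes _ | _         | _     = ⊥-elim ∘ ∉𝔉⊥ P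
    ... | no _      | no _  | yes _     | _     = λ _ → ∈𝔉⁅bot⁆ P _
    ... | no _      | no A''≢⁅bot⁆ | no _ | yes A'≡⁅bot⁆ =
      ⊥-elim (A''≢⁅bot⁆ (⁅bot⁆≤▽⇒≡⁅bot⁆ P A''-antichain (subst (λ B → _≤▽_ P B A'') A'≡⁅bot⁆ A'≤A'')))
    ... | no _      | no _  | no _      | no _  =
      minS-monotone P {blocking r A''} {blocking r A'} (blocking-antitoneʳ {r} {A'} {A''} 0≤r A'≤A'')

corollary2p5 : (P : BoundedPoset) → (ω : Subset (BoundedPoset.n P) → ℤ) → Admissible P ω →
    (r' r'' : ℚ) → 0ℚ ≤ r' → r' ≤ r'' → r'' < 1ℚ →
    (A' A'' : Subset (BoundedPoset.n P)) → IsAntichain P A' → IsAntichain P A'' →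
    _≤▽_ P A' A'' →
    _≤▽_ P (blocker P ω r'' A'') (blocker P ω r' A'') × _≤▽_ P (blocker P ω r' A'') (blocker P ω r' A')
corollary2p5 P ω admissible r' r'' 0≤r' r'≤r'' _ A' A'' _ A''-antichain A'≤A'' =
  blocker-antitoneˡ P ω admissible r'≤r'' A'' ,
  blocker-antitoneʳ P ω admissible {A' = A'} {A''} 0≤r' A''-antichain A'≤A''
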